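{- Assume the setting described in the context (in particular $b>4000$), with $c=c_\nu^\pm$ for some $\nu\in\{1,2,3\}$ and one of the cases (a), (b), (c) for the data $(z_0,x_0,y_2,x_2,\lambda)$. Suppose $p_l=V_m$ for some positive integers $m$ and $l$, and put $x=p_l=V_m$. If the Diophantine quadruple $\{2,b,c,\frac{x^2-1}{2}\}$ is not regular, then $$\Delta:=l-\lambda-\nu m\neq 0.$$
   Context: Let $k$ be a positive integer, $b=2k(k+1)$, $r=2k+1$ (so $2b+1=r^2$), and assume $b>4000$. For each sign $\pm$ define $s_0^\pm=1$, $s_1^\pm=r\pm2$, $s_{\nu+2}^\pm=2rs_{\nu+1}^\pm-s_\nu^\pm$, $t_0^\pm=\pm1$, $t_1^\pm=b\pm r$, $t_{\nu+2}^\pm=2rt_{\nu+1}^\pm-t_\nu^\pm$, and $c_\nu^\pm=((s_\nu^\pm)^2-1)/2$. Fix $\nu\in\{1,2,3\}$ and a sign, and write $c=c_\nu^\pm$, $s=s_\nu^\pm$, $t=t_\nu^\pm$, so $2c+1=s^2$, $bc+1=t^2$. Integers $z_0,x_0,y_2,x_2$ and $\lambda$ are given by one of the cases: (a) $z_0\in\{1,-1\}$, $x_0=1$, $y_2=1$, $x_2=1$, $\lambda=0$; (b) $z_0=t$, $x_0=r$, $y_2\in\{1,-1\}$, $x_2=1$, $\lambda=1$; (c) $z_0=-t$, $x_0=r$, $y_2\in\{1,-1\}$, $x_2=1$, $\lambda=-1$. Define sequences $V_0=x_0$, $V_1=sx_0+2z_0$, $V_{m+2}=2sV_{m+1}-V_m$,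 and $p_0=x_2$, $p_1=rx_2+2y_2$, $p_{l+2}=2rp_{l+1}-p_l$. A Diophantine quadruple is a set of four distinct positive integers such that the product of any two increased by $1$ is a perfect square; $\{a,b,c,d\}$ is regular if $(d+c-a-b)^2=4(ab+1)(cd+1)$. -}

module Defs where

open import Data.Nat as ℕ using (ℕ; zero; suc)
open import Data.Integer using (ℤ; +_; -_; _+_; _-_; _*_; _<_; 0ℤ; 1ℤ; -1ℤ)
open import Data.Sign using (Sign)
open import Data.Product using (∃; _×_)
open import Data.Sum using (_⊎_)
open import Relation.Binary.PropositionalEquality using (_≡_; _≢_)

rec2 : ℤ → ℤ → ℤ → ℕ → ℤ
rec2 a u₀ u₁ zero = u₀
rec2 a u₀ u₁ (suc zero) = u₁
rec2 a u₀ u₁ (suc (suc n)) = (+ 2) * a * rec2 a u₀ u₁ (suc n) - rec2 a u₀ u₁ n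

sgn : Sign → ℤ
sgn Sign.+ = 1ℤ
sgn Sign.- = -1ℤ

module Setting (k : ℕ) where
  b : ℤ
  b = + (2 ℕ.* k ℕ.* (k ℕ.+ 1))

  r : ℤ
  r = + (2 ℕ.* k ℕ.+ 1)

  s : Sign → ℕ → ℤ
  s σ = rec2 r 1ℤ (r + sgn σ * + 2)

  t : Sign → ℕ → ℤ
  t σ = rec2 r (sgn σ) (b + sgn σ * r)

-- the three cases (a), (b), (c) for the data (z₀, x₀, y₂, x₂, λ), given r and t = t_ν^±
data Case (r t : ℤ) : ℤ → ℤ → ℤ → ℤ → ℤ → Set where
  caseA : ∀ {z₀} → (z₀ ≡ 1ℤ ⊎ z₀ ≡ -1ℤ) → Case r t z₀ 1ℤ 1ℤ 1ℤ 0ℤ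
  caseB : ∀ {y₂} → (y₂ ≡ 1ℤ ⊎ y₂ ≡ -1ℤ) → Case r t t r y₂ 1ℤ 1ℤ
  caseC : ∀ {y₂} → (y₂ ≡ 1ℤ ⊎ y₂ ≡ -1ℤ) → Case r t (- t) r y₂ 1ℤ -1ℤ

IsSquare : ℤ → Set
IsSquare n = ∃ λ m → n ≡ m * m

IsDiophantineQuadruple : ℤ → ℤ → ℤ → ℤ → Set
IsDiophantineQuadruple a b c d =
  (0ℤ < a × 0ℤ < b × 0ℤ < c × 0ℤ < d) ×
  (a ≢ b × a ≢ c × a ≢ d × b ≢ c × b ≢ d × c ≢ d) ×
  (IsSquare (a * b + 1ℤ) × IsSquare (a * c + 1ℤ) × IsSquare (a * d + 1ℤ) ×
   IsSquare (b * c + 1ℤ) × IsSquare (b * d + 1ℤ) × IsSquare (c * d + 1ℤ))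

IsRegular : ℤ → ℤ → ℤ → ℤ → Set
IsRegular a b c d =
  (d + c - a - b) * (d + c - a - b) ≡ + 4 * (a * b + 1ℤ) * (c * d + 1ℤ)

-- Suppose Δ = 0, i.e. l = ν (m − 1) + ν + λ.  Along this arithmetic progression the sequence p
-- satisfies the recurrence of V with 2s replaced by 2 T_ν(r), T_ν the Chebyshev polynomial, since
-- u_{n+2ν} + u_n = 2 T_ν(a) u_{n+ν} for any solution of u_{n+2} = 2a u_{n+1} − u_n.  As s_ν^± lies
-- above resp. below T_ν(r), the dominating sequence P minus the other one Q is a supersolution
-- of the smaller recurrence; once P − Q ≥ 0 and its increment is ≥ 1, it stays ≥ 1.  So V and p can meet
-- along the progression only at one explicit index j ∈ {0, 1}, and there either they differ, or l = 0,
-- or {2, b, c, (x² − 1)/2} is regular.  Writing k = 45 + J, all initial values are polynomials in J ≥ 0,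
-- and each needed inequality or identity is checked by normalizing the polynomial and inspecting signs
-- of coefficients.

module Submission where

open import Defs
open import Data.Nat as ℕ using (ℕ; zero; suc; z≤n; s≤s; _∸_)
import Data.Nat.Properties as ℕₚ
import Data.Nat.Tactic.RingSolver as ℕ-Solver
open import Data.Integer using (ℤ; +_; -_; _+_; _-_; _*_; _≤_; _<_; +≤+; 0ℤ; 1ℤ; -1ℤ)
open import Data.Integer.Properties
  using (_≤?_; _≟_; +-mono-≤; +-monoˡ-≤; ≤-refl; ≤-trans; ≤-reflexive; i≤j⇒0≤j-i; 0≤i-j⇒j≤i;
         i-j≡0⇒i≡j; +-inverseʳ; +-identityˡ; +-identityʳ; *-zeroʳ; *-cancelˡ-≡; +-injective; pos-+; pos-*;
         drop‿+<+; module ≤-Reasoning)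
open import Data.Integer.Tactic.RingSolver using (solve-∀)
open import Data.Sign using (Sign)
open import Data.List using (List; []; _∷_; map)
open import Data.List.Relation.Unary.All using (All; []; _∷_; all?)
open import Data.Empty using (⊥; ⊥-elim)
open import Data.Unit using (⊤)
open import Data.Product using (_×_; _,_; proj₁; proj₂)
open import Data.Sum using (inj₁; inj₂)
open import Relation.Binary.Definitions using (tri<; tri≈; tri>)
open import Relation.Nullary using (¬_; yes; no)
open import Relation.Nullary.Decidable using (True; toWitness)
open import Relation.Binary.PropositionalEquality

Poly : Set
Poly = List ℤ

⟦_⟧ₚ : Poly → ℤ → ℤ
⟦ [] ⟧ₚ x = 0ℤ
⟦ c ∷ p ⟧ₚ x = c + x * ⟦ p ⟧ₚ x

infixl 6 _+ₚ_
infixl 7 _*ₚ_ _·ₚ_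

_+ₚ_ : Poly → Poly → Poly
[] +ₚ q = q
(a ∷ p) +ₚ [] = a ∷ p
(a ∷ p) +ₚ (b ∷ q) = a + b ∷ p +ₚ q

_·ₚ_ : ℤ → Poly → Poly
c ·ₚ p = map (c *_) p

-ₚ_ : Poly → Poly
-ₚ_ = map (-_)

_*ₚ_ : Poly → Poly → Poly
[] *ₚ q = []
(a ∷ p) *ₚ q = a ·ₚ q +ₚ (0ℤ ∷ p *ₚ q)

rec2ₚ : Poly → Poly → Poly → ℕ → Poly
rec2ₚ a u₀ u₁ zero = u₀
rec2ₚ a u₀ u₁ (suc zero) = u₁
rec2ₚ a u₀ u₁ (suc (suc n)) = (+ 2 ·ₚ a) *ₚ rec2ₚ a u₀ u₁ (suc n) +ₚ -ₚ rec2ₚ a u₀ u₁ n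

+ₚ-sound : ∀ p q x → ⟦ p +ₚ q ⟧ₚ x ≡ ⟦ p ⟧ₚ x + ⟦ q ⟧ₚ x
+ₚ-sound [] q x = sym (+-identityˡ (⟦ q ⟧ₚ x))
+ₚ-sound (a ∷ p) [] x = sym (+-identityʳ (a + x * ⟦ p ⟧ₚ x))
+ₚ-sound (a ∷ p) (b ∷ q) x =
  trans (cong (λ y → a + b + x * y) (+ₚ-sound p q x)) (lemma a b (⟦ p ⟧ₚ x) (⟦ q ⟧ₚ x) x)
  where lemma : ∀ a b P Q x → a + b + x * (P + Q) ≡ a + x * P + (b + x * Q)
        lemma = solve-∀

·ₚ-sound : ∀ c p x → ⟦ c ·ₚ p ⟧ₚ x ≡ c * ⟦ p ⟧ₚ x
·ₚ-sound c [] x = sym (*-zeroʳ c)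
·ₚ-sound c (a ∷ p) x =
  trans (cong (λ y → c * a + x * y) (·ₚ-sound c p x)) (lemma c a (⟦ p ⟧ₚ x) x)
  where lemma : ∀ c a P x → c * a + x * (c * P) ≡ c * (a + x * P)
        lemma = solve-∀

-ₚ-sound : ∀ p x → ⟦ -ₚ p ⟧ₚ x ≡ - ⟦ p ⟧ₚ x
-ₚ-sound [] x = refl
-ₚ-sound (a ∷ p) x =
  trans (cong (λ y → - a + x * y) (-ₚ-sound p x)) (lemma a (⟦ p ⟧ₚ x) x)
  where lemma : ∀ a P x → - a + x * - P ≡ - (a + x * P)
        lemma = solve-∀

*ₚ-sound : ∀ p q x → ⟦ p *ₚ q ⟧ₚ x ≡ ⟦ p ⟧ₚ x * ⟦ q ⟧ₚ x
*ₚ-sound [] q x = refl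
*ₚ-sound (a ∷ p) q x = begin
  ⟦ a ·ₚ q +ₚ (0ℤ ∷ p *ₚ q) ⟧ₚ x        ≡⟨ +ₚ-sound (a ·ₚ q) (0ℤ ∷ p *ₚ q) x ⟩
  ⟦ a ·ₚ q ⟧ₚ x + (0ℤ + x * ⟦ p *ₚ q ⟧ₚ x) ≡⟨ cong₂ (λ y z → y + (0ℤ + x * z)) (·ₚ-sound a q x) (*ₚ-sound p q x) ⟩
  a * Q + (0ℤ + x * (P * Q))            ≡⟨ lemma a P Q x ⟩
  (a + x * P) * Q                       ∎
  where
  open ≡-Reasoning
  P = ⟦ p ⟧ₚ x
  Q = ⟦ q ⟧ₚ x
  lemma : ∀ a P Q x → a * Q + (0ℤ + x * (P * Q)) ≡ (a + x * P) * Q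
  lemma = solve-∀

rec2ₚ-sound : ∀ a u₀ u₁ n x → ⟦ rec2ₚ a u₀ u₁ n ⟧ₚ x ≡ rec2 (⟦ a ⟧ₚ x) (⟦ u₀ ⟧ₚ x) (⟦ u₁ ⟧ₚ x) n
rec2ₚ-sound a u₀ u₁ zero x = refl
rec2ₚ-sound a u₀ u₁ (suc zero) x = refl
rec2ₚ-sound a u₀ u₁ (suc (suc n)) x = begin
  ⟦ (+ 2 ·ₚ a) *ₚ rec2ₚ a u₀ u₁ (suc n) +ₚ -ₚ rec2ₚ a u₀ u₁ n ⟧ₚ x
    ≡⟨ +ₚ-sound ((+ 2 ·ₚ a) *ₚ rec2ₚ a u₀ u₁ (suc n)) (-ₚ rec2ₚ a u₀ u₁ n) x ⟩
  ⟦ (+ 2 ·ₚ a) *ₚ rec2ₚ a u₀ u₁ (suc n) ⟧ₚ x + ⟦ -ₚ rec2ₚ a u₀ u₁ n ⟧ₚ x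
    ≡⟨ cong₂ _+_ (*ₚ-sound (+ 2 ·ₚ a) (rec2ₚ a u₀ u₁ (suc n)) x) (-ₚ-sound (rec2ₚ a u₀ u₁ n) x) ⟩
  ⟦ + 2 ·ₚ a ⟧ₚ x * ⟦ rec2ₚ a u₀ u₁ (suc n) ⟧ₚ x - ⟦ rec2ₚ a u₀ u₁ n ⟧ₚ x
    ≡⟨ cong₂ (λ y z → y * z - ⟦ rec2ₚ a u₀ u₁ n ⟧ₚ x) (·ₚ-sound (+ 2) a x) (rec2ₚ-sound a u₀ u₁ (suc n) x) ⟩
  + 2 * ⟦ a ⟧ₚ x * rec2 (⟦ a ⟧ₚ x) (⟦ u₀ ⟧ₚ x) (⟦ u₁ ⟧ₚ x) (suc n) - ⟦ rec2ₚ a u₀ u₁ n ⟧ₚ x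
    ≡⟨ cong (λ y → + 2 * ⟦ a ⟧ₚ x * rec2 (⟦ a ⟧ₚ x) (⟦ u₀ ⟧ₚ x) (⟦ u₁ ⟧ₚ x) (suc n) - y) (rec2ₚ-sound a u₀ u₁ n x) ⟩
  rec2 (⟦ a ⟧ₚ x) (⟦ u₀ ⟧ₚ x) (⟦ u₁ ⟧ₚ x) (suc (suc n)) ∎
  where open ≡-Reasoning

infixl 6 _⊕_ _⊝_
infixl 7 _⊗_

data Expr : Set where
  var : Expr
  con : ℤ → Expr
  _⊕_ _⊗_ : Expr → Expr → Expr
  neg : Expr → Expr
  rec2ₑ : Expr → Expr → Expr → ℕ → Expr

_⊝_ : Expr → Expr → Expr
e ⊝ f = e ⊕ neg f

⟦_⟧ : Expr → ℤ → ℤ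
⟦ var ⟧ x = x
⟦ con c ⟧ x = c
⟦ e ⊕ f ⟧ x = ⟦ e ⟧ x + ⟦ f ⟧ x
⟦ e ⊗ f ⟧ x = ⟦ e ⟧ x * ⟦ f ⟧ x
⟦ neg e ⟧ x = - ⟦ e ⟧ x
⟦ rec2ₑ a u₀ u₁ n ⟧ x = rec2 (⟦ a ⟧ x) (⟦ u₀ ⟧ x) (⟦ u₁ ⟧ x) n

normal : Expr → Poly
normal var = 0ℤ ∷ 1ℤ ∷ []
normal (con c) = c ∷ []
normal (e ⊕ f) = normal e +ₚ normal f
normal (e ⊗ f) = normal e *ₚ normal f
normal (neg e) = -ₚ normal e
normal (rec2ₑ a u₀ u₁ n) = rec2ₚ (normal a) (normal u₀) (normal u₁) n

normal-sound : ∀ e x → ⟦ normal e ⟧ₚ x ≡ ⟦ e ⟧ x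
normal-sound var x = lemma x
  where lemma : ∀ x → 0ℤ + x * (1ℤ + x * 0ℤ) ≡ x
        lemma = solve-∀
normal-sound (con c) x = lemma c x
  where lemma : ∀ c x → c + x * 0ℤ ≡ c
        lemma = solve-∀
normal-sound (e ⊕ f) x = trans (+ₚ-sound (normal e) (normal f) x) (cong₂ _+_ (normal-sound e x) (normal-sound f x))
normal-sound (e ⊗ f) x = trans (*ₚ-sound (normal e) (normal f) x) (cong₂ _*_ (normal-sound e x) (normal-sound f x))
normal-sound (neg e) x = trans (-ₚ-sound (normal e) x) (cong -_ (normal-sound e x))
normal-sound (rec2ₑ a u₀ u₁ n) x = begin
  ⟦ rec2ₚ (normal a) (normal u₀) (normal u₁) n ⟧ₚ x
    ≡⟨ rec2ₚ-sound (normal a) (normal u₀) (normal u₁) n x ⟩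
  rec2 (⟦ normal a ⟧ₚ x) (⟦ normal u₀ ⟧ₚ x) (⟦ normal u₁ ⟧ₚ x) n
    ≡⟨ cong₂ (λ y z → rec2 y z (⟦ normal u₁ ⟧ₚ x) n) (normal-sound a x) (normal-sound u₀ x) ⟩
  rec2 (⟦ a ⟧ x) (⟦ u₀ ⟧ x) (⟦ normal u₁ ⟧ₚ x) n
    ≡⟨ cong (λ y → rec2 (⟦ a ⟧ x) (⟦ u₀ ⟧ x) y n) (normal-sound u₁ x) ⟩
  rec2 (⟦ a ⟧ x) (⟦ u₀ ⟧ x) (⟦ u₁ ⟧ x) n ∎
  where open ≡-Reasoning

infix 4 _≤ₑ_ _≈ₑ_

record _≤ₑ_ (e f : Expr) : Set where
  field coefficients-nonneg : True (all? (0ℤ ≤?_) (normal (f ⊝ e)))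

record _≈ₑ_ (e f : Expr) : Set where
  field coefficients-zero : True (all? (_≟ 0ℤ) (normal (e ⊝ f)))

0≤i⇒0≤j⇒0≤i*j : ∀ {i j} → 0ℤ ≤ i → 0ℤ ≤ j → 0ℤ ≤ i * j
0≤i⇒0≤j⇒0≤i*j (+≤+ {n = m} _) (+≤+ {n = n} _) = subst (0ℤ ≤_) (pos-* m n) (+≤+ z≤n)

⟦⟧ₚ-nonneg : ∀ {x} p → 0ℤ ≤ x → All (0ℤ ≤_) p → 0ℤ ≤ ⟦ p ⟧ₚ x
⟦⟧ₚ-nonneg [] 0≤x [] = +≤+ z≤n
⟦⟧ₚ-nonneg (c ∷ p) 0≤x (0≤c ∷ 0≤p) = +-mono-≤ 0≤c (0≤i⇒0≤j⇒0≤i*j 0≤x (⟦⟧ₚ-nonneg p 0≤x 0≤p))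

⟦⟧ₚ-zero : ∀ {x} p → All (_≡ 0ℤ) p → ⟦ p ⟧ₚ x ≡ 0ℤ
⟦⟧ₚ-zero [] [] = refl
⟦⟧ₚ-zero {x} (.0ℤ ∷ p) (refl ∷ p≡0) = trans (cong (λ y → 0ℤ + x * y) (⟦⟧ₚ-zero p p≡0)) (lemma x)
  where lemma : ∀ x → 0ℤ + x * 0ℤ ≡ 0ℤ
        lemma = solve-∀

≤ₑ-sound : ∀ {e f} → e ≤ₑ f → ∀ {x} → 0ℤ ≤ x → ⟦ e ⟧ x ≤ ⟦ f ⟧ x
≤ₑ-sound {e} {f} e≤f {x} 0≤x = 0≤i-j⇒j≤i (subst (0ℤ ≤_) (normal-sound (f ⊝ e) x)
  (⟦⟧ₚ-nonneg (normal (f ⊝ e)) 0≤x (toWitness (_≤ₑ_.coefficients-nonneg e≤f))))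

≈ₑ-sound : ∀ {e f} → e ≈ₑ f → ∀ x → ⟦ e ⟧ x ≡ ⟦ f ⟧ x
≈ₑ-sound {e} {f} e≈f x = i-j≡0⇒i≡j _ _ (trans (sym (normal-sound (e ⊝ f) x))
  (⟦⟧ₚ-zero (normal (e ⊝ f)) (toWitness (_≈ₑ_.coefficients-zero e≈f))))


Recurrence : ℤ → (ℕ → ℤ) → Set
Recurrence a u = ∀ n → u (suc (suc n)) ≡ + 2 * a * u (suc n) - u n

chebyshevT : ℕ → ℤ → ℤ
chebyshevT ν a = rec2 a 1ℤ a ν

module _ {a : ℤ} {u : ℕ → ℤ} (rec : Recurrence a u) where

  chebyshev-shift-step : ∀ μ i →
    u (suc μ ℕ.+ (suc μ ℕ.+ suc i)) + u (suc i) ≡ + 2 * chebyshevT (suc μ) a * u (suc μ ℕ.+ suc i) →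
    u (μ ℕ.+ (μ ℕ.+ suc (suc i))) + u (suc (suc i)) ≡ + 2 * chebyshevT μ a * u (μ ℕ.+ suc (suc i)) →
    u (suc (suc μ) ℕ.+ (suc (suc μ) ℕ.+ i)) + u i ≡ + 2 * chebyshevT (suc (suc μ)) a * u (suc (suc μ) ℕ.+ i)
  chebyshev-shift-step μ i shift₁ shift₀ = begin
    u (suc (suc μ) ℕ.+ (suc (suc μ) ℕ.+ i)) + u i
      ≡⟨ cong (λ n → u n + u i) (outer μ i) ⟩
    u (suc (suc Y)) + u i
      ≡⟨ cong (_+ u i) (rec Y) ⟩
    + 2 * a * u (suc Y) - u Y + u i
      ≡⟨ regroup a (u (suc Y)) (u Y) (u (suc i)) (u i) ⟩
    + 2 * a * (u (suc Y) + u (suc i)) - (u Y + (+ 2 * a * u (suc i) - u i))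
      ≡⟨ cong (λ z → + 2 * a * (u (suc Y) + u (suc i)) - (u Y + z)) (sym (rec i)) ⟩
    + 2 * a * (u (suc Y) + u (suc i)) - (u Y + u (suc (suc i)))
      ≡⟨ cong₂ (λ y z → + 2 * a * y - z) shift₁′ shift₀ ⟩
    + 2 * a * (+ 2 * T₁ * u X) - + 2 * T₀ * u X
      ≡⟨ collect a T₀ T₁ (u X) ⟩
    + 2 * (+ 2 * a * T₁ - T₀) * u X
      ≡⟨ cong (λ n → + 2 * (+ 2 * a * T₁ - T₀) * u n) (centre μ i) ⟩
    + 2 * chebyshevT (suc (suc μ)) a * u (suc (suc μ) ℕ.+ i) ∎
    where
    open ≡-Reasoning
    T₀ = chebyshevT μ a
    T₁ = chebyshevT (suc μ) a
    X = μ ℕ.+ suc (suc i)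
    Y = μ ℕ.+ X
    outer : ∀ μ i → suc (suc μ) ℕ.+ (suc (suc μ) ℕ.+ i) ≡ suc (suc (μ ℕ.+ (μ ℕ.+ suc (suc i))))
    outer = ℕ-Solver.solve-∀
    inner : ∀ μ i → suc μ ℕ.+ (suc μ ℕ.+ suc i) ≡ suc (μ ℕ.+ (μ ℕ.+ suc (suc i)))
    inner = ℕ-Solver.solve-∀
    shifted-centre : ∀ μ i → suc μ ℕ.+ suc i ≡ μ ℕ.+ suc (suc i)
    shifted-centre = ℕ-Solver.solve-∀
    centre : ∀ μ i → μ ℕ.+ suc (suc i) ≡ suc (suc μ) ℕ.+ i
    centre = ℕ-Solver.solve-∀
    shift₁′ : u (suc Y) + u (suc i) ≡ + 2 * T₁ * u X
    shift₁′ = subst₂ (λ m n → u m + u (suc i) ≡ + 2 * T₁ * u n) (inner μ i) (shifted-centre μ i) shift₁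
    regroup : ∀ a uY₁ uY ui₁ ui → + 2 * a * uY₁ - uY + ui ≡ + 2 * a * (uY₁ + ui₁) - (uY + (+ 2 * a * ui₁ - ui))
    regroup = solve-∀
    collect : ∀ a T₀ T₁ x → + 2 * a * (+ 2 * T₁ * x) - + 2 * T₀ * x ≡ + 2 * (+ 2 * a * T₁ - T₀) * x
    collect = solve-∀

  chebyshev-shift : ∀ ν i → u (ν ℕ.+ (ν ℕ.+ i)) + u i ≡ + 2 * chebyshevT ν a * u (ν ℕ.+ i)
  chebyshev-shift zero i = double (u i)
    where double : ∀ x → x + x ≡ + 2 * 1ℤ * x
          double = solve-∀
  chebyshev-shift (suc zero) i = trans (cong (_+ u i) (rec i)) (cancel a (u (suc i)) (u i))
    where cancel : ∀ a x y → + 2 * a * x - y + y ≡ + 2 * a * x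
          cancel = solve-∀
  chebyshev-shift (suc (suc μ)) i =
    chebyshev-shift-step μ i (chebyshev-shift (suc μ) (suc i)) (chebyshev-shift μ (suc (suc i)))

  recurrence-along-progression : ∀ ν c → Recurrence (chebyshevT ν a) (λ i → u (ν ℕ.* i ℕ.+ c))
  recurrence-along-progression ν c i = begin
    u (ν ℕ.* suc (suc i) ℕ.+ c)        ≡⟨ cong u (outer ν i c) ⟩
    u (ν ℕ.+ (ν ℕ.+ x))                 ≡⟨ move (u (ν ℕ.+ (ν ℕ.+ x))) (u x) ⟩
    u (ν ℕ.+ (ν ℕ.+ x)) + u x - u x     ≡⟨ cong (_- u x) (chebyshev-shift ν x) ⟩
    + 2 * chebyshevT ν a * u (ν ℕ.+ x) - u x ≡⟨ cong (λ n → + 2 * chebyshevT ν a * u n - u x) (inner ν i c) ⟩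
    + 2 * chebyshevT ν a * u (ν ℕ.* suc i ℕ.+ c) - u x ∎
    where
    open ≡-Reasoning
    x = ν ℕ.* i ℕ.+ c
    outer : ∀ ν i c → ν ℕ.* suc (suc i) ℕ.+ c ≡ ν ℕ.+ (ν ℕ.+ (ν ℕ.* i ℕ.+ c))
    outer = ℕ-Solver.solve-∀
    inner : ∀ ν i c → ν ℕ.+ (ν ℕ.* i ℕ.+ c) ≡ ν ℕ.* suc i ℕ.+ c
    inner = ℕ-Solver.solve-∀
    move : ∀ y z → y ≡ y + z - z
    move = solve-∀

1≤i-j⇒i≢j : ∀ {i j} → 1ℤ ≤ i - j → i ≢ j
1≤i-j⇒i≢j {i} 1≤i-i refl with subst (1ℤ ≤_) (+-inverseʳ i) 1≤i-i
... | +≤+ ()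

supersolution-increments : ∀ {b : ℤ} {u : ℕ → ℤ} → 1ℤ ≤ b → (∀ n → + 2 * b * u (suc n) - u n ≤ u (suc (suc n))) →
  0ℤ ≤ u 0 → u 0 ≤ u 1 → ∀ n → 0ℤ ≤ u n × u 1 - u 0 ≤ u (suc n) - u n
supersolution-increments 1≤b super 0≤u₀ u₀≤u₁ zero = 0≤u₀ , ≤-refl
supersolution-increments {b} {u} 1≤b super 0≤u₀ u₀≤u₁ (suc n)
  with supersolution-increments 1≤b super 0≤u₀ u₀≤u₁ n
... | 0≤uₙ , δ≤Δₙ = 0≤uₙ₊₁ , δ≤Δₙ₊₁
  where
  open ≤-Reasoning
  0≤uₙ₊₁ : 0ℤ ≤ u (suc n)
  0≤uₙ₊₁ = begin
    0ℤ                        ≤⟨ +-mono-≤ 0≤uₙ (≤-trans (i≤j⇒0≤j-i u₀≤u₁) δ≤Δₙ) ⟩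
    u n + (u (suc n) - u n)   ≡⟨ cancel (u n) (u (suc n)) ⟩
    u (suc n)                 ∎
    where cancel : ∀ x y → x + (y - x) ≡ y
          cancel = solve-∀
  δ≤Δₙ₊₁ : u 1 - u 0 ≤ u (suc (suc n)) - u (suc n)
  δ≤Δₙ₊₁ = begin
    u 1 - u 0                                             ≤⟨ δ≤Δₙ ⟩
    u (suc n) - u n                                       ≡⟨ sym (+-identityˡ (u (suc n) - u n)) ⟩
    0ℤ + (u (suc n) - u n)                                ≤⟨ +-monoˡ-≤ (u (suc n) - u n) 0≤extra ⟩
    + 2 * (b - 1ℤ) * u (suc n) + (u (suc n) - u n)       ≡⟨ regroup b (u (suc n)) (u n) ⟩
    + 2 * b * u (suc n) - u n - u (suc n)                 ≤⟨ +-monoˡ-≤ (- u (suc n)) (super n) ⟩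
    u (suc (suc n)) - u (suc n)                           ∎
    where
    0≤extra : 0ℤ ≤ + 2 * (b - 1ℤ) * u (suc n)
    0≤extra = 0≤i⇒0≤j⇒0≤i*j (0≤i⇒0≤j⇒0≤i*j {+ 2} (+≤+ z≤n) (i≤j⇒0≤j-i 1≤b)) 0≤uₙ₊₁
    regroup : ∀ b x y → + 2 * (b - 1ℤ) * x + (x - y) ≡ + 2 * b * x - y - x
    regroup = solve-∀

-- P − Q is a supersolution of Q's recurrence, the excess being 2(a − b) P ≥ 0.
never-meets-after-start : ∀ {a b P Q} → Recurrence a P → Recurrence b Q → b ≤ a → 1ℤ ≤ b →
  0ℤ ≤ P 0 → P 0 ≤ P 1 → Q 0 ≤ P 0 → 1ℤ ≤ (P 1 - Q 1) - (P 0 - Q 0) →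
  ∀ n → P (suc n) ≢ Q (suc n)
never-meets-after-start {a} {b} {P} {Q} recP recQ b≤a 1≤b 0≤P₀ P₀≤P₁ Q₀≤P₀ 1≤δ n =
  1≤i-j⇒i≢j {P (suc n)} {Q (suc n)} (begin
    1ℤ                         ≤⟨ 1≤δ ⟩
    E 1 - E 0                  ≤⟨ proj₂ (E-increments n) ⟩
    E (suc n) - E n            ≡⟨ sym (+-identityˡ (E (suc n) - E n)) ⟩
    0ℤ + (E (suc n) - E n)     ≤⟨ +-monoˡ-≤ (E (suc n) - E n) (proj₁ (E-increments n)) ⟩
    E n + (E (suc n) - E n)    ≡⟨ regroup (E n) (E (suc n)) ⟩
    E (suc n)                  ∎)
  where
  open ≤-Reasoning
  regroup : ∀ x y → x + (y - x) ≡ y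
  regroup = solve-∀
  E : ℕ → ℤ
  E i = P i - Q i
  P-nonneg : ∀ i → 0ℤ ≤ P i
  P-nonneg i = proj₁ (supersolution-increments {a} {P} (≤-trans 1≤b b≤a) (λ m → ≤-reflexive (sym (recP m))) 0≤P₀ P₀≤P₁ i)
  E-super : ∀ i → + 2 * b * E (suc i) - E i ≤ E (suc (suc i))
  E-super i = begin
    + 2 * b * E (suc i) - E i                                             ≡⟨ sym (+-identityˡ (+ 2 * b * E (suc i) - E i)) ⟩
    0ℤ + (+ 2 * b * E (suc i) - E i)                                      ≤⟨ +-monoˡ-≤ (+ 2 * b * E (suc i) - E i) (0≤i⇒0≤j⇒0≤i*j (0≤i⇒0≤j⇒0≤i*j {+ 2} (+≤+ z≤n) (i≤j⇒0≤j-i b≤a)) (P-nonneg (suc i))) ⟩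
    + 2 * (a - b) * P (suc i) + (+ 2 * b * E (suc i) - E i)               ≡⟨ expand a b (P (suc i)) (P i) (Q (suc i)) (Q i) ⟩
    (+ 2 * a * P (suc i) - P i) - (+ 2 * b * Q (suc i) - Q i)             ≡⟨ cong₂ _-_ (sym (recP i)) (sym (recQ i)) ⟩
    E (suc (suc i))                                                       ∎
    where expand : ∀ a b p₁ p₀ q₁ q₀ → + 2 * (a - b) * p₁ + (+ 2 * b * (p₁ - q₁) - (p₀ - q₀)) ≡ (+ 2 * a * p₁ - p₀) - (+ 2 * b * q₁ - q₀)
          expand = solve-∀
  E-increments : ∀ i → 0ℤ ≤ E i × E 1 - E 0 ≤ E (suc i) - E i
  E-increments = supersolution-increments {b} {E} 1≤b E-super (i≤j⇒0≤j-i Q₀≤P₀) (0≤i-j⇒j≤i {E 1} {E 0} (≤-trans (+≤+ z≤n) 1≤δ))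

meets-only-at : ∀ {a b P Q} j → Recurrence a P → Recurrence b Q → b ≤ a → 1ℤ ≤ b →
  0ℤ ≤ P j → P j ≤ P (suc j) → Q j ≤ P j → 1ℤ ≤ (P (suc j) - Q (suc j)) - (P j - Q j) →
  (∀ i → i ℕ.< j → P i ≢ Q i) → ∀ n → P n ≡ Q n → n ≡ j
meets-only-at {P = P} {Q} j recP recQ b≤a 1≤b 0≤Pⱼ Pⱼ≤Pⱼ₊₁ Qⱼ≤Pⱼ 1≤δ before n Pₙ≡Qₙ with ℕₚ.<-cmp n j
... | tri< n<j _ _ = ⊥-elim (before n n<j Pₙ≡Qₙ)
... | tri≈ _ n≡j _ = n≡j
... | tri> _ _ j<n = ⊥-elim (never-meets-after-start (λ i → recP (i ℕ.+ j)) (λ i → recQ (i ℕ.+ j))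
        b≤a 1≤b 0≤Pⱼ Pⱼ≤Pⱼ₊₁ Qⱼ≤Pⱼ 1≤δ (n ∸ suc j) (subst (λ m → P m ≡ Q m) (sym n≡) Pₙ≡Qₙ))
  where
  n≡ : suc (n ∸ suc j ℕ.+ j) ≡ n
  n≡ = trans (sym (ℕₚ.+-suc (n ∸ suc j) j)) (ℕₚ.m∸n+n≡m j<n)

-- Doubling d + c − 2 − b turns it into x² + s² − 6 − 2b.
regular-of-squares : ∀ {b c d s x} → + 2 * c + 1ℤ ≡ s * s → + 2 * d + 1ℤ ≡ x * x →
  (x * x + s * s - + 6 - + 2 * b) * (x * x + s * s - + 6 - + 2 * b)
    ≡ + 4 * (+ 2 * b + 1ℤ) * ((s * s - 1ℤ) * (x * x - 1ℤ) + + 4) →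
  IsRegular (+ 2) b c d
regular-of-squares {b} {c} {d} {s} {x} hc hd identity = *-cancelˡ-≡ (+ 4) _ _ (begin
  + 4 * (L * L)                                                   ≡⟨ lhs b c d ⟩
  (D + C - + 6 - + 2 * b) * (D + C - + 6 - + 2 * b)               ≡⟨ subst₂ (λ S X → (X + S - + 6 - + 2 * b) * (X + S - + 6 - + 2 * b) ≡ + 4 * (+ 2 * b + 1ℤ) * ((S - 1ℤ) * (X - 1ℤ) + + 4)) (sym hc) (sym hd) identity ⟩
  + 4 * (+ 2 * b + 1ℤ) * ((C - 1ℤ) * (D - 1ℤ) + + 4)              ≡⟨ rhs b c d ⟩
  + 4 * (+ 4 * (+ 2 * b + 1ℤ) * (c * d + 1ℤ))                      ∎)
  where
  open ≡-Reasoning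
  L = d + c - + 2 - b
  C = + 2 * c + 1ℤ
  D = + 2 * d + 1ℤ
  lhs : ∀ b c d → + 4 * ((d + c - + 2 - b) * (d + c - + 2 - b))
    ≡ (+ 2 * d + 1ℤ + (+ 2 * c + 1ℤ) - + 6 - + 2 * b) * (+ 2 * d + 1ℤ + (+ 2 * c + 1ℤ) - + 6 - + 2 * b)
  lhs = solve-∀
  rhs : ∀ b c d → + 4 * (+ 2 * b + 1ℤ) * ((+ 2 * c + 1ℤ - 1ℤ) * (+ 2 * d + 1ℤ - 1ℤ) + + 4)
    ≡ + 4 * (+ 4 * (+ 2 * b + 1ℤ) * (c * d + 1ℤ))
  rhs = solve-∀

record Sequence : Set where
  field
    coeff : Expr
    term : ℕ → Expr
open Sequence

Recurrent : ℤ → Sequence → Set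
Recurrent J S = Recurrence (⟦ coeff S ⟧ J) (λ i → ⟦ term S i ⟧ J)

BelowBefore : Sequence → Sequence → ℕ → Set
BelowBefore P Q zero = ⊤
BelowBefore P Q (suc j) = (con 1ℤ ≤ₑ term Q j ⊝ term P j) × BelowBefore P Q j

record Separation (P Q : Sequence) (j : ℕ) : Set where
  field
    coeff-≤ : coeff Q ≤ₑ coeff P
    coeff-≥1 : con 1ℤ ≤ₑ coeff Q
    term-nonneg : con 0ℤ ≤ₑ term P j
    term-grows : term P j ≤ₑ term P (suc j)
    gap-nonneg : term Q j ≤ₑ term P j
    gap-grows : con 1ℤ ≤ₑ (term P (suc j) ⊝ term Q (suc j)) ⊝ (term P j ⊝ term Q j)
    below : BelowBefore P Q j

below-before-sound : ∀ {P Q J} j → BelowBefore P Q j → 0ℤ ≤ J → ∀ i → i ℕ.< j → ⟦ term P i ⟧ J ≢ ⟦ term Q i ⟧ J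
below-before-sound {P} {Q} (suc j) (Qⱼ>Pⱼ , below) 0≤J i i<1+j with ℕₚ.m<1+n⇒m<n∨m≡n i<1+j
... | inj₁ i<j = below-before-sound j below 0≤J i i<j
... | inj₂ refl = λ Pᵢ≡Qᵢ → 1≤i-j⇒i≢j (≤ₑ-sound Qⱼ>Pⱼ 0≤J) (sym Pᵢ≡Qᵢ)

separation-sound : ∀ {P Q j J} → Separation P Q j → 0ℤ ≤ J → Recurrent J P → Recurrent J Q →
  ∀ n → ⟦ term P n ⟧ J ≡ ⟦ term Q n ⟧ J → n ≡ j
separation-sound {P} {Q} {j} {J} sep 0≤J recP recQ = meets-only-at j recP recQ
  (sound coeff-≤) (sound coeff-≥1) (sound term-nonneg) (sound term-grows) (sound gap-nonneg) (sound gap-grows)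
  (below-before-sound j below 0≤J)
  where
  open Separation sep
  sound : ∀ {e f} → e ≤ₑ f → ⟦ e ⟧ J ≤ ⟦ f ⟧ J
  sound e≤f = ≤ₑ-sound e≤f 0≤J

leading trailing : {A : Set} → Sign → A → A → A
leading Sign.+ x y = x
leading Sign.- x y = y
trailing Sign.+ x y = y
trailing Sign.- x y = x

oriented : ∀ {A : Set} σ (R : A → A → Set) {x y} → R x y → R y x → R (leading σ x y) (trailing σ x y)
oriented Sign.+ R xy yx = xy
oriented Sign.- R xy yx = yx

-- r and b as polynomials in J = k − 45; the hypothesis b > 4000 is exactly what makes J ≥ 0.
rₑ bₑ : Expr
rₑ = con (+ 2) ⊗ var ⊕ con (+ 91)
bₑ = con (+ 2) ⊗ var ⊗ var ⊕ con (+ 182) ⊗ var ⊕ con (+ 4140)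

sₑ tₑ : Sign → ℕ → Expr
sₑ σ = rec2ₑ rₑ (con 1ℤ) (rₑ ⊕ con (sgn σ) ⊗ con (+ 2))
tₑ σ = rec2ₑ rₑ (con (sgn σ)) (bₑ ⊕ con (sgn σ) ⊗ rₑ)

-- The cases (a), (b), (c), indexed by the sign of z₀ in case (a) and of y₂ in cases (b), (c).
data Variant : Set where
  a₊ a₋ b₊ b₋ c₊ c₋ : Variant

lam-of y₂-of : Variant → ℤ
lam-of a₊ = 0ℤ
lam-of a₋ = 0ℤ
lam-of b₊ = 1ℤ
lam-of b₋ = 1ℤ
lam-of c₊ = -1ℤ
lam-of c₋ = -1ℤ
y₂-of b₋ = -1ℤ
y₂-of c₋ = -1ℤ
y₂-of _ = 1ℤ

x₀ₑ : Variant → Expr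
x₀ₑ a₊ = con 1ℤ
x₀ₑ a₋ = con 1ℤ
x₀ₑ _ = rₑ

z₀ₑ : Sign → ℕ → Variant → Expr
z₀ₑ σ ν a₊ = con 1ℤ
z₀ₑ σ ν a₋ = con -1ℤ
z₀ₑ σ ν b₊ = tₑ σ ν
z₀ₑ σ ν b₋ = tₑ σ ν
z₀ₑ σ ν c₊ = neg (tₑ σ ν)
z₀ₑ σ ν c₋ = neg (tₑ σ ν)

-- ν + λ, so that Δ = 0 says l = ν (m − 1) + offset ν v.
offset : ℕ → Variant → ℕ
offset ν a₊ = ν
offset ν a₋ = ν
offset ν b₊ = suc ν
offset ν b₋ = suc ν
offset ν c₊ = ν ∸ 1
offset ν c₋ = ν ∸ 1

offset-spec : ∀ μ v → + suc μ + lam-of v ≡ + offset (suc μ) v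
offset-spec μ a₊ = +-identityʳ (+ suc μ)
offset-spec μ a₋ = +-identityʳ (+ suc μ)
offset-spec μ b₊ = cong +_ (ℕₚ.+-comm (suc μ) 1)
offset-spec μ b₋ = cong +_ (ℕₚ.+-comm (suc μ) 1)
offset-spec μ c₊ = refl
offset-spec μ c₋ = refl

index-from-Δ : ∀ {ν c₀ l n} lam → + ν + lam ≡ + c₀ → + l - lam - + ν * + suc n ≡ 0ℤ → l ≡ ν ℕ.* n ℕ.+ c₀
index-from-Δ {ν} {c₀} {l} {n} lam ν+lam≡c₀ Δ≡0 = +-injective (begin
  + l                                                         ≡⟨ split (+ l) lam (+ ν) (+ n) ⟩
  (+ l - lam - + ν * (1ℤ + + n)) + (+ ν * + n + (+ ν + lam)) ≡⟨ cong₂ (λ x y → x + (+ ν * + n + y)) Δ≡0 ν+lam≡c₀ ⟩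
  0ℤ + (+ ν * + n + + c₀)                                     ≡⟨ +-identityˡ (+ ν * + n + + c₀) ⟩
  + ν * + n + + c₀                                            ≡⟨ cong (_+ + c₀) (sym (pos-* ν n)) ⟩
  + (ν ℕ.* n) + + c₀                                          ≡⟨ sym (pos-+ (ν ℕ.* n) c₀) ⟩
  + (ν ℕ.* n ℕ.+ c₀)                                          ∎)
  where
  open ≡-Reasoning
  split : ∀ l lam ν n → l ≡ (l - lam - ν * (1ℤ + n)) + (ν * n + (ν + lam))
  split = solve-∀

RegularIdentity : Expr → Expr → Set
RegularIdentity s x =
  (x ⊗ x ⊕ s ⊗ s ⊝ con (+ 6) ⊝ con (+ 2) ⊗ bₑ) ⊗ (x ⊗ x ⊕ s ⊗ s ⊝ con (+ 6) ⊝ con (+ 2) ⊗ bₑ)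
    ≈ₑ con (+ 4) ⊗ (con (+ 2) ⊗ bₑ ⊕ con 1ℤ) ⊗ ((s ⊗ s ⊝ con 1ℤ) ⊗ (x ⊗ x ⊝ con 1ℤ) ⊕ con (+ 4))

module Instance (ν : ℕ) (σ : Sign) (v : Variant) where

  s : Expr
  s = sₑ σ ν

  V p : ℕ → Expr
  V = rec2ₑ s (x₀ₑ v) (s ⊗ x₀ₑ v ⊕ con (+ 2) ⊗ z₀ₑ σ ν v)
  p = rec2ₑ rₑ (con 1ℤ) (rₑ ⊗ con 1ℤ ⊕ con (+ 2) ⊗ con (y₂-of v))

  -- V and p along the progression of Δ = 0; for σ = + we have s ≥ T_ν(r), so U dominates.
  U W P Q : Sequence
  U = record { coeff = s ; term = λ n → V (suc n) }
  W = record { coeff = rec2ₑ rₑ (con 1ℤ) rₑ ν ; term = λ n → p (ν ℕ.* n ℕ.+ offset ν v) }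
  P = leading σ U W
  Q = trailing σ U W

  U-recurrent : ∀ J → Recurrent J U
  U-recurrent J n = refl

  W-recurrent : ∀ J → Recurrent J W
  W-recurrent J = recurrence-along-progression {u = λ l → ⟦ p l ⟧ J} (λ l → refl) ν (offset ν v)

  data Outcome (j : ℕ) : Set where
    apart : con 1ℤ ≤ₑ term P j ⊝ term Q j → Outcome j
    index-vanishes : ν ℕ.* j ℕ.+ offset ν v ≡ 0 → Outcome j
    regular : RegularIdentity s (term W j) → Outcome j

  record Certificate : Set where
    constructor certificate
    field
      index : ℕ
      separation : Separation P Q index
      outcome : Outcome index

  Meeting : ℤ → ℕ → Sequence → Sequence → Set
  Meeting J n X Y = Recurrent J X × Recurrent J Y × ⟦ term X n ⟧ J ≡ ⟦ term Y n ⟧ J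

  refute : Certificate → ∀ {J} → 0ℤ ≤ J → (n l : ℕ) → 1 ℕ.≤ l → l ≡ ν ℕ.* n ℕ.+ offset ν v →
    ⟦ p l ⟧ J ≡ ⟦ V (suc n) ⟧ J →
    (c d : ℤ) → + 2 * c + 1ℤ ≡ ⟦ s ⟧ J * ⟦ s ⟧ J → + 2 * d + 1ℤ ≡ ⟦ p l ⟧ J * ⟦ p l ⟧ J →
    ¬ IsRegular (+ 2) (⟦ bₑ ⟧ J) c d → ⊥
  refute (certificate j separation outcome) {J} 0≤J n l 1≤l refl meet c d hc hd irregular
    with oriented σ (Meeting J n) (U-recurrent J , W-recurrent J , sym meet) (W-recurrent J , U-recurrent J , meet)
  ... | P-rec , Q-rec , Pₙ≡Qₙ with separation-sound separation 0≤J P-rec Q-rec n Pₙ≡Qₙ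
  ... | refl with outcome
  ...   | apart gap = 1≤i-j⇒i≢j (≤ₑ-sound gap 0≤J) Pₙ≡Qₙ
  ...   | index-vanishes l≡0 = ℕₚ.<⇒≢ 1≤l (sym l≡0)
  ...   | regular identity =
    irregular (regular-of-squares {⟦ bₑ ⟧ J} {c} {d} {⟦ s ⟧ J} {⟦ term W j ⟧ J} hc hd (≈ₑ-sound identity J))

open Instance using (Certificate; certificate; apart; index-vanishes; regular)

-- The index is the only n at which V (suc n) can equal p (ν n + offset); the outcome rules out that n.
certify : ∀ ν → 1 ℕ.≤ ν → ν ℕ.≤ 3 → ∀ σ v → Certificate ν σ v
certify (suc (suc (suc (suc _)))) _ (s≤s (s≤s (s≤s ()))) _ _
certify 1 _ _ Sign.+ a₊ = certificate 0 _ (apart _)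
certify 1 _ _ Sign.+ a₋ = certificate 1 _ (regular _)
certify 1 _ _ Sign.+ b₊ = certificate 0 _ (regular _)
certify 1 _ _ Sign.+ b₋ = certificate 0 _ (apart _)
certify 1 _ _ Sign.+ c₊ = certificate 0 _ (index-vanishes refl)
certify 1 _ _ Sign.+ c₋ = certificate 0 _ (index-vanishes refl)
certify 1 _ _ Sign.- a₊ = certificate 0 _ (apart _)
certify 1 _ _ Sign.- a₋ = certificate 0 _ (apart _)
certify 1 _ _ Sign.- b₊ = certificate 0 _ (apart _)
certify 1 _ _ Sign.- b₋ = certificate 0 _ (regular _)
certify 1 _ _ Sign.- c₊ = certificate 0 _ (index-vanishes refl)
certify 1 _ _ Sign.- c₋ = certificate 0 _ (index-vanishes refl)
certify 2 _ _ Sign.+ a₊ = certificate 0 _ (apart _)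
certify 2 _ _ Sign.+ a₋ = certificate 1 _ (apart _)
certify 2 _ _ Sign.+ b₊ = certificate 0 _ (regular _)
certify 2 _ _ Sign.+ b₋ = certificate 0 _ (apart _)
certify 2 _ _ Sign.+ c₊ = certificate 0 _ (regular _)
certify 2 _ _ Sign.+ c₋ = certificate 0 _ (apart _)
certify 2 _ _ Sign.- a₊ = certificate 0 _ (apart _)
certify 2 _ _ Sign.- a₋ = certificate 0 _ (apart _)
certify 2 _ _ Sign.- b₊ = certificate 0 _ (apart _)
certify 2 _ _ Sign.- b₋ = certificate 0 _ (regular _)
certify 2 _ _ Sign.- c₊ = certificate 0 _ (apart _)
certify 2 _ _ Sign.- c₋ = certificate 0 _ (regular _)
certify 3 _ _ Sign.+ a₊ = certificate 0 _ (apart _)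
certify 3 _ _ Sign.+ a₋ = certificate 1 _ (apart _)
certify 3 _ _ Sign.+ b₊ = certificate 0 _ (regular _)
certify 3 _ _ Sign.+ b₋ = certificate 0 _ (apart _)
certify 3 _ _ Sign.+ c₊ = certificate 0 _ (regular _)
certify 3 _ _ Sign.+ c₋ = certificate 0 _ (apart _)
certify 3 _ _ Sign.- a₊ = certificate 0 _ (apart _)
certify 3 _ _ Sign.- a₋ = certificate 0 _ (apart _)
certify 3 _ _ Sign.- b₊ = certificate 0 _ (apart _)
certify 3 _ _ Sign.- b₋ = certificate 0 _ (regular _)
certify 3 _ _ Sign.- c₊ = certificate 0 _ (apart _)
certify 3 _ _ Sign.- c₋ = certificate 0 _ (regular _)

-- lemma4 after k, with r and b abstracted: Setting.r k is not definitionally a polynomial in k − 45.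
ΔNonzero : ℤ → ℤ → Set
ΔNonzero r b =
  (ν : ℕ) → 1 ℕ.≤ ν → ν ℕ.≤ 3 → (σ : Sign) →
  let s = rec2 r 1ℤ (r + sgn σ * + 2) ν
      t = rec2 r (sgn σ) (b + sgn σ * r) ν in
  (z₀ x₀ y₂ x₂ lam : ℤ) → Case r t z₀ x₀ y₂ x₂ lam →
  (m l : ℕ) → 1 ℕ.≤ m → 1 ℕ.≤ l →
  let x = rec2 r x₂ (r * x₂ + + 2 * y₂) l in
  x ≡ rec2 s x₀ (s * x₀ + + 2 * z₀) m →
  (c d : ℤ) → + 2 * c + 1ℤ ≡ s * s → + 2 * d + 1ℤ ≡ x * x →
  IsDiophantineQuadruple (+ 2) b c d → ¬ IsRegular (+ 2) b c d →
  + l - lam - + ν * + m ≢ 0ℤ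

module _ {J : ℤ} (0≤J : 0ℤ ≤ J) where

  Δ-nonzero-for : ∀ ν → 1 ℕ.≤ ν → ν ℕ.≤ 3 → ∀ σ v → let open Instance ν σ v in
    (m l : ℕ) → 1 ℕ.≤ m → 1 ℕ.≤ l → ⟦ p l ⟧ J ≡ ⟦ V m ⟧ J →
    (c d : ℤ) → + 2 * c + 1ℤ ≡ ⟦ s ⟧ J * ⟦ s ⟧ J → + 2 * d + 1ℤ ≡ ⟦ p l ⟧ J * ⟦ p l ⟧ J →
    IsDiophantineQuadruple (+ 2) (⟦ bₑ ⟧ J) c d → ¬ IsRegular (+ 2) (⟦ bₑ ⟧ J) c d →
    + l - lam-of v - + ν * + m ≢ 0ℤ
  Δ-nonzero-for (suc μ) 1≤ν ν≤3 σ v (suc n) l _ 1≤l meet c d hc hd _ irregular Δ≡0 =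
    Instance.refute (suc μ) σ v (certify (suc μ) 1≤ν ν≤3 σ v) 0≤J n l 1≤l
      (index-from-Δ (lam-of v) (offset-spec μ v) Δ≡0) meet c d hc hd irregular

  Δ-nonzero-at : ΔNonzero (⟦ rₑ ⟧ J) (⟦ bₑ ⟧ J)
  Δ-nonzero-at ν 1≤ν ν≤3 σ _ _ _ _ _ (caseA (inj₁ refl)) = Δ-nonzero-for ν 1≤ν ν≤3 σ a₊
  Δ-nonzero-at ν 1≤ν ν≤3 σ _ _ _ _ _ (caseA (inj₂ refl)) = Δ-nonzero-for ν 1≤ν ν≤3 σ a₋
  Δ-nonzero-at ν 1≤ν ν≤3 σ _ _ _ _ _ (caseB (inj₁ refl)) = Δ-nonzero-for ν 1≤ν ν≤3 σ b₊
  Δ-nonzero-at ν 1≤ν ν≤3 σ _ _ _ _ _ (caseB (inj₂ refl)) = Δ-nonzero-for ν 1≤ν ν≤3 σ b₋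
  Δ-nonzero-at ν 1≤ν ν≤3 σ _ _ _ _ _ (caseC (inj₁ refl)) = Δ-nonzero-for ν 1≤ν ν≤3 σ c₊
  Δ-nonzero-at ν 1≤ν ν≤3 σ _ _ _ _ _ (caseC (inj₂ refl)) = Δ-nonzero-for ν 1≤ν ν≤3 σ c₋

r-at : ∀ j → ⟦ rₑ ⟧ (+ j) ≡ Setting.r (45 ℕ.+ j)
r-at j = begin
  + 2 * + j + + 91            ≡⟨ cong (_+ + 91) (sym (pos-* 2 j)) ⟩
  + (2 ℕ.* j) + + 91          ≡⟨ sym (pos-+ (2 ℕ.* j) 91) ⟩
  + (2 ℕ.* j ℕ.+ 91)          ≡⟨ cong +_ (expand j) ⟩
  + (2 ℕ.* (45 ℕ.+ j) ℕ.+ 1)  ∎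
  where
  open ≡-Reasoning
  expand : ∀ j → 2 ℕ.* j ℕ.+ 91 ≡ 2 ℕ.* (45 ℕ.+ j) ℕ.+ 1
  expand = ℕ-Solver.solve-∀

b-at : ∀ j → ⟦ bₑ ⟧ (+ j) ≡ Setting.b (45 ℕ.+ j)
b-at j = begin
  + 2 * + j * + j + + 182 * + j + + 4140
    ≡⟨ cong₂ (λ x y → x + y + + 4140) (trans (cong (_* + j) (sym (pos-* 2 j))) (sym (pos-* (2 ℕ.* j) j)))
             (sym (pos-* 182 j)) ⟩
  + (2 ℕ.* j ℕ.* j) + + (182 ℕ.* j) + + 4140
    ≡⟨ cong (_+ + 4140) (sym (pos-+ (2 ℕ.* j ℕ.* j) (182 ℕ.* j))) ⟩
  + (2 ℕ.* j ℕ.* j ℕ.+ 182 ℕ.* j) + + 4140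
    ≡⟨ sym (pos-+ (2 ℕ.* j ℕ.* j ℕ.+ 182 ℕ.* j) 4140) ⟩
  + (2 ℕ.* j ℕ.* j ℕ.+ 182 ℕ.* j ℕ.+ 4140)
    ≡⟨ cong +_ (expand j) ⟩
  + (2 ℕ.* (45 ℕ.+ j) ℕ.* (45 ℕ.+ j ℕ.+ 1)) ∎
  where
  open ≡-Reasoning
  expand : ∀ j → 2 ℕ.* j ℕ.* j ℕ.+ 182 ℕ.* j ℕ.+ 4140 ≡ 2 ℕ.* (45 ℕ.+ j) ℕ.* (45 ℕ.+ j ℕ.+ 1)
  expand = ℕ-Solver.solve-∀

45≤k : ∀ k → + 4000 < Setting.b k → 45 ℕ.≤ k
45≤k k 4000<b with 45 ℕ.≤? k
... | yes 45≤k = 45≤k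
... | no 45≰k = ⊥-elim (ℕₚ.<⇒≱ (drop‿+<+ 4000<b) (ℕₚ.≤-trans b≤3960 (ℕₚ.≤ᵇ⇒≤ 3960 4000 _)))
  where
  k≤44 : k ℕ.≤ 44
  k≤44 = ℕₚ.≤-pred (ℕₚ.≰⇒> 45≰k)
  b≤3960 : 2 ℕ.* k ℕ.* (k ℕ.+ 1) ℕ.≤ 3960
  b≤3960 = ℕₚ.*-mono-≤ (ℕₚ.*-mono-≤ (ℕₚ.≤-refl {2}) k≤44) (ℕₚ.+-monoˡ-≤ 1 k≤44)

Δ-nonzero : ∀ k → 45 ℕ.≤ k → ΔNonzero (Setting.r k) (Setting.b k)
Δ-nonzero k 45≤k = subst (λ k → ΔNonzero (Setting.r k) (Setting.b k)) (ℕₚ.m+[n∸m]≡n 45≤k)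
  (subst₂ ΔNonzero (r-at (k ∸ 45)) (b-at (k ∸ 45)) (Δ-nonzero-at {+ (k ∸ 45)} (+≤+ z≤n)))

lemma4 : (k : ℕ) → 1 ℕ.≤ k → + 4000 < Setting.b k →
           (ν : ℕ) → 1 ℕ.≤ ν → ν ℕ.≤ 3 → (σ : Sign) →
           (z₀ x₀ y₂ x₂ lam : ℤ) →
           Case (Setting.r k) (Setting.t k σ ν) z₀ x₀ y₂ x₂ lam →
           (m l : ℕ) → 1 ℕ.≤ m → 1 ℕ.≤ l →
           rec2 (Setting.r k) x₂ (Setting.r k * x₂ + + 2 * y₂) l
             ≡ rec2 (Setting.s k σ ν) x₀ (Setting.s k σ ν * x₀ + + 2 * z₀) m →
           (c d : ℤ) →
           + 2 * c + 1ℤ ≡ Setting.s k σ ν * Setting.s k σ ν →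
           + 2 * d + 1ℤ
             ≡ rec2 (Setting.r k) x₂ (Setting.r k * x₂ + + 2 * y₂) l
               * rec2 (Setting.r k) x₂ (Setting.r k * x₂ + + 2 * y₂) l →
           IsDiophantineQuadruple (+ 2) (Setting.b k) c d →
           ¬ IsRegular (+ 2) (Setting.b k) c d →
           + l - lam - + ν * + m ≢ 0ℤ
lemma4 k _ 4000<b = Δ-nonzero k (45≤k k 4000<b)
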